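{- Let $a,b$ be positive integers and let $k$ be a positive integer dividing $b$. Then $$q^{b^2/k-b} \binom{k(a+2)-b(2-1/k)}{b/k}_q$$ is the generating function (by size) for all $(b/k)$-modular diagrams $\Lambda$ of length $b$, contained inside an $a\times b$ rectangle, satisfying: (1) $\Lambda$ has exactly $k$ rows labeled $i$, for each $i=1,2,\dots,b/k$; (2) if $\Sigma_i$ denotes the sum of the lengths of all rows of $\Lambda$ labeled $i$, then $\Sigma_1\le\Sigma_2\le\dots\le\Sigma_{b/k}\le k(a+1)-b$; (3) all rows of $\Lambda$ have length at least $b/k-1$; (4) for each label, the lengths of the longest and the shortest row carrying that label differ by at most $1$.
   Context: $\binom{n}{m}_q$ denotes the Gaussian polynomial ($q$-binomial coefficient). Modular diagrams (nonstandard definition): Fix a partition $\mu$ and positive integers $k\ge l(\mu)$ and $N$. An $N$-modular diagram of length $k$ consists of $k$ rows, the $i$-th row having length $\mu_i\ge 0$ (rows of length zero allowed), drawn as the Ferrers diagram of $\mu$ with a zeroth column of $k$ cells added on the left (so row $i$ has $\mu_i+1$ cells). Every cell is labeled with an integer between $1$ and $N$, every cell of a row other than its rightmost cell is labeled $N$, and labels in each column weakly decrease from top to bottom. A row is labeled $i$ if its rightmost cell (the zeroth cell if the row has length zero) is labeled $i$. The length of a row is $\mu_i$, and the size of the diagram is $\sum_i\mu_i$; generating functions count diagrams by $q^{\text{size}}$. The diagram is contained inside an $a\times b$ rectangle if it has length $b$ and all row lengths are at most $a$. -}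

module Defs where

open import Data.Nat using (ℕ; zero; suc; _+_; _*_; _∸_; _≤_; _<_; _≟_)
open import Data.List using (List; []; _∷_; length; filter; map)
open import Data.Nat.ListAction using (sum)
open import Data.List.Relation.Unary.All using (All)
open import Data.Vec using (Vec; lookup; toList)
open import Data.Fin using (Fin; toℕ)
open import Data.Maybe using (Maybe; just; nothing)
open import Data.Product using (_×_)
open import Relation.Binary.PropositionalEquality using (_≡_)

-- Polynomials in q with ℕ coefficients are represented by their
-- coefficient functions  ℕ → ℕ  (coefficient of q^d).

shift : ℕ → (ℕ → ℕ) → ℕ → ℕ
shift zero    f d       = f d
shift (suc e) f zero    = 0
shift (suc e) f (suc d) = shift e f d

-- gauss n m d = coefficient of q^d in the Gaussian polynomial [n choose m]_q,
-- defined by the q-Pascal recurrence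
--   [n+1 choose m+1]_q = [n choose m]_q + q^(m+1) [n choose m+1]_q,
--   [n choose 0]_q = 1,  [0 choose m+1]_q = 0.
gauss : ℕ → ℕ → ℕ → ℕ
gauss n       zero    zero    = 1
gauss n       zero    (suc d) = 0
gauss zero    (suc m) d       = 0
gauss (suc n) (suc m) d       = gauss n m d + shift (suc m) (gauss n (suc m)) d

-- A diagram of length b is a vector of b rows; row i is the
-- list of labels of its cells, from the zeroth cell (leftmost) to the
-- rightmost cell.  Row i has μ_i + 1 cells, so its length is μ_i.

Diagram : ℕ → Set
Diagram b = Vec (List ℕ) b

row : ∀ {b} → Diagram b → Fin b → List ℕ
row D i = lookup D i

rowLen : List ℕ → ℕ
rowLen r = length r ∸ 1

cell : List ℕ → ℕ → Maybe ℕ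
cell []      c       = nothing
cell (x ∷ r) zero    = just x
cell (x ∷ r) (suc c) = cell r c

rowLabel : List ℕ → ℕ
rowLabel []          = 0
rowLabel (x ∷ [])    = x
rowLabel (x ∷ y ∷ r) = rowLabel (y ∷ r)

size : ∀ {b} → Diagram b → ℕ
size D = sum (map rowLen (toList D))

record IsModular (N b : ℕ) (D : Diagram b) : Set where
  field
    nonempty   : ∀ i → 1 ≤ length (row D i)
    partition  : ∀ i j → toℕ i ≤ toℕ j → rowLen (row D j) ≤ rowLen (row D i)
    labelRange : ∀ i → All (λ x → 1 ≤ x × x ≤ N) (row D i)
    innerN     : ∀ i c → c < rowLen (row D i) → cell (row D i) c ≡ just N
    columns    : ∀ i j → toℕ i ≤ toℕ j → ∀ c x y →
                 cell (row D i) c ≡ just x → cell (row D j) c ≡ just y → y ≤ x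

InsideBox : ∀ (a : ℕ) {b} → Diagram b → Set
InsideBox a D = ∀ i → rowLen (row D i) ≤ a

rowsLabeled : ∀ {b} → Diagram b → ℕ → ℕ
rowsLabeled D ℓ = length (filter (λ r → rowLabel r ≟ ℓ) (toList D))

labelSum : ∀ {b} → Diagram b → ℕ → ℕ
labelSum D ℓ = sum (map rowLen (filter (λ r → rowLabel r ≟ ℓ) (toList D)))

-- The diagrams counted in Corollary 3.5 (N plays the role of b/k).
record Good (a b k N : ℕ) (D : Diagram b) : Set where
  field
    modular : IsModular N b D
    inBox   : InsideBox a D
    cond1   : ∀ ℓ → 1 ≤ ℓ → ℓ ≤ N → rowsLabeled D ℓ ≡ k
    -- (2) Σ_1 ≤ Σ_2 ≤ ... ≤ Σ_N ≤ k(a+1) − b   (last written without truncation)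
    cond2   : ∀ ℓ → 1 ≤ ℓ → ℓ < N → labelSum D ℓ ≤ labelSum D (suc ℓ)
    cond2'  : labelSum D N + b ≤ k * (a + 1)
    cond3   : ∀ i → N ∸ 1 ≤ rowLen (row D i)
    cond4   : ∀ i j → rowLabel (row D i) ≡ rowLabel (row D j) →
              rowLen (row D i) ≤ rowLen (row D j) + 1

-- Every row of a modular diagram is determined by its length and its label, and in a modular
-- diagram the rows are sorted lexicographically by (length, label); so a diagram is just the
-- multiset of these pairs.  For a good diagram, conditions (1) and (4) say that the k rows
-- labelled ℓ have lengths differing by at most one, so they are the even split of Σ_ℓ into k
-- parts, and condition (3) says Σ_ℓ ≥ k (N − 1), where N = b / k.  Hence a good diagram is the
-- same as a sequence 0 ≤ s_1 ≤ … ≤ s_N ≤ M with Σ_ℓ = k (N − 1) + s_ℓ and M = k (a + 2) − 2 b,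
-- and its size is s_1 + … + s_N + N k (N − 1) = s_1 + … + s_N + b² / k − b.  Such sequences
-- are counted by the Gaussian polynomial [M + N choose N]_q.  When 2 b > k (a + 2) there are
-- no good diagrams, and the Gaussian polynomial of the statement vanishes as well.

module Submission where

open import Defs
open import Level using (Level)
open import Function using (_∘_)
open import Function.Bundles using (_⇔_; mk⇔)
open import Data.Nat using (ℕ; zero; suc; pred; _+_; _*_; _∸_; _≤_; _<_; _≟_; _≤?_; z≤n; s≤s; s≤s⁻¹; NonZero)
open import Data.Nat.Properties
open import Data.Nat.DivMod using (_/_; _%_; m≡m%n+[m/n]*n; m%n<n; m*n/n≡m; /-monoˡ-≤)
open import Data.Nat.Divisibility using (_∣_; divides)
open import Data.Nat.ListAction using (sum)
open import Data.Nat.ListAction.Properties using (sum-++; sum-↭)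
open import Data.Nat.Tactic.RingSolver using (solve-∀)
open import Data.List using (List; []; _∷_; [_]; length; filter; map; _++_; replicate; applyUpTo)
import Data.List.Properties as List
open import Data.List.Extrema.Nat using (min; min≤⊤; min≤xs; argmin-sel)
open import Data.List.Relation.Unary.All as All using (All; []; _∷_)
import Data.List.Relation.Unary.All.Properties as All
open import Data.List.Relation.Unary.Any as Any using (here; there)
open import Data.List.Relation.Unary.AllPairs using ([]; _∷_)
open import Data.List.Relation.Unary.Linked as Linked using (Linked; []; [-]; _∷_)
import Data.List.Relation.Unary.Linked.Properties as Linked
open import Data.List.Relation.Unary.Unique.Propositional using (Unique)
import Data.List.Relation.Unary.Unique.Propositional.Properties as Unique
open import Data.List.Relation.Unary.Sorted.TotalOrder.Properties using (↗↭↗⇒≋)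
import Data.List.Relation.Binary.Pointwise as Pointwise
open import Data.List.Relation.Binary.Permutation.Propositional
  using (_↭_; ↭-refl; ↭-sym; ↭-trans; ↭-reflexive; prep; ↭⇒↭ₛ′; module PermutationReasoning)
import Data.List.Relation.Binary.Permutation.Propositional.Properties as Perm
open import Data.List.Membership.Propositional using (_∈_)
open import Data.List.Membership.Propositional.Properties
  using (∈-map⁺; ∈-map⁻; ∈-++⁺ˡ; ∈-++⁺ʳ; ∈-filter⁺; ∈-filter⁻; ∈-∃++)
import Data.List.Sort
open import Data.Maybe using (just)
import Data.Maybe.Properties as Maybe
open import Data.Product using (Σ-syntax; _×_; _,_; proj₁; proj₂)
open import Data.Sum using (_⊎_; inj₁; inj₂)
open import Data.Fin as Fin using (Fin; toℕ)
open import Data.Vec as Vec using (Vec; toList; lookup)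
open import Data.Vec.Properties using (toList-injective; cast-is-id)
import Data.Vec.Relation.Unary.All as VecAll
import Data.Vec.Relation.Unary.All.Properties as VecAll
import Data.Vec.Relation.Unary.Any as VecAny
import Data.Vec.Relation.Unary.Any.Properties as VecAny
open import Data.Vec.Membership.Propositional.Properties using (∈-toList⁻; ∈-toList⁺; ∈-lookup)
open import Relation.Nullary using (¬_; yes; no; contradiction; _×-dec_)
open import Relation.Unary using (Pred; Decidable)
open import Relation.Binary using (DecidableEquality; TotalOrder)
import Relation.Binary.Construct.On as On
import Relation.Binary.Construct.Flip.Ord as Flip
open import Relation.Binary.PropositionalEquality hiding ([_])

private variable
  α β p q : Level
  A : Set α
  B : Set β

count : {P : Pred A p} → Decidable P → List A → ℕ
count P? xs = length (filter P? xs)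

module _ {P : Pred A p} (P? : Decidable P) where

  count-++ : ∀ xs ys → count P? (xs ++ ys) ≡ count P? xs + count P? ys
  count-++ xs ys = trans (cong length (List.filter-++ P? xs ys)) (List.length-++ (filter P? xs))

  count-accept : ∀ {x} xs → P x → count P? (x ∷ xs) ≡ suc (count P? xs)
  count-accept xs px = cong length (List.filter-accept P? px)

  count-reject : ∀ {x} xs → ¬ P x → count P? (x ∷ xs) ≡ count P? xs
  count-reject xs ¬px = cong length (List.filter-reject P? ¬px)

  count-none : ∀ {xs} → All (¬_ ∘ P) xs → count P? xs ≡ 0
  count-none ¬Ps = cong length (List.filter-none P? ¬Ps)

count-map : {P : Pred B p} (P? : Decidable P) (f : A → B) (xs : List A) →
            count P? (map f xs) ≡ count (P? ∘ f) xs
count-map P? f []       = refl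
count-map P? f (x ∷ xs) with P? (f x)
... | yes _ = cong suc (count-map P? f xs)
... | no  _ = count-map P? f xs

count-cong : {P : Pred A p} {Q : Pred A q} (P? : Decidable P) (Q? : Decidable Q) →
             ∀ {xs} → All (λ x → (P x → Q x) × (Q x → P x)) xs → count P? xs ≡ count Q? xs
count-cong P? Q? []                     = refl
count-cong P? Q? {x ∷ _} ((to , from) ∷ h) with P? x | Q? x
... | yes _  | yes _  = cong suc (count-cong P? Q? h)
... | yes px | no ¬qx = contradiction (to px) ¬qx
... | no ¬px | yes qx = contradiction (from qx) ¬px
... | no _   | no _   = count-cong P? Q? h

count-≟-cong : ∀ {f g : A → ℕ} {xs} d → All (λ x → f x ≡ g x) xs →
               count (λ x → f x ≟ d) xs ≡ count (λ x → g x ≟ d) xs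
count-≟-cong d f≡g = count-cong _ _ (All.map (λ fx≡gx → trans (sym fx≡gx) , trans fx≡gx) f≡g)

-- Gaussian polynomials count weakly increasing sequences

shift-cong : ∀ e {f g : ℕ → ℕ} → (∀ d → f d ≡ g d) → ∀ d → shift e f d ≡ shift e g d
shift-cong zero    f≗g d       = f≗g d
shift-cong (suc e) f≗g zero    = refl
shift-cong (suc e) f≗g (suc d) = shift-cong e f≗g d

shift-zero : ∀ e {f : ℕ → ℕ} → (∀ d → f d ≡ 0) → ∀ d → shift e f d ≡ 0
shift-zero zero    f≗0 d       = f≗0 d
shift-zero (suc e) f≗0 zero    = refl
shift-zero (suc e) f≗0 (suc d) = shift-zero e f≗0 d

count-+-shift : (f : A → ℕ) (e : ℕ) (xs : List A) (d : ℕ) →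
                count (λ x → f x + e ≟ d) xs ≡ shift e (λ d′ → count (λ x → f x ≟ d′) xs) d
count-+-shift f zero xs d = count-≟-cong d (All.universal (λ x → +-identityʳ (f x)) xs)
count-+-shift f (suc e) xs zero = count-none _ (All.universal
  (λ x eq → 0≢1+n (trans (sym eq) (+-suc (f x) e))) xs)
count-+-shift f (suc e) xs (suc d) = trans
  (count-cong _ _ (All.universal (λ x → (λ eq → suc-injective (trans (sym (+-suc (f x) e)) eq))
                                      , (λ eq → trans (+-suc (f x) e) (cong suc eq))) xs))
  (count-+-shift f e xs d)

gauss-vanishes : ∀ {n m} → n < m → ∀ d → gauss n m d ≡ 0
gauss-vanishes {zero}  {suc m} _         d = refl
gauss-vanishes {suc n} {suc m} (s≤s n<m) d =
  cong₂ _+_ (gauss-vanishes n<m d) (shift-zero (suc m) (gauss-vanishes (m<n⇒m<1+n n<m)) d)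

record IncreasingSeq (M m : ℕ) (s : List ℕ) : Set where
  field
    length≡ : length s ≡ m
    sorted  : Linked _≤_ s
    bounded : All (_≤ M) s

-- Split by whether the first entry is 0; this is the q-Pascal recurrence defining gauss.
increasingSeqs : ℕ → ℕ → List (List ℕ)
increasingSeqs M       zero    = [ [] ]
increasingSeqs zero    (suc m) = map (0 ∷_) (increasingSeqs zero m)
increasingSeqs (suc M) (suc m) =
  map (0 ∷_) (increasingSeqs (suc M) m) ++ map (map suc) (increasingSeqs M (suc m))

module _ {M m : ℕ} where

  0∷-increasing : ∀ {s} → IncreasingSeq M m s → IncreasingSeq M (suc m) (0 ∷ s)
  0∷-increasing {[]}    record { length≡ = refl } =
    record { length≡ = refl ; sorted = [-] ; bounded = z≤n ∷ [] }
  0∷-increasing {_ ∷ _} seq = record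
    { length≡ = cong suc length≡ ; sorted = z≤n ∷ sorted ; bounded = z≤n ∷ bounded }
    where open IncreasingSeq seq

  map-suc-increasing : ∀ {s} → IncreasingSeq M m s → IncreasingSeq (suc M) m (map suc s)
  map-suc-increasing {s} seq = record
    { length≡ = trans (List.length-map suc s) length≡
    ; sorted  = Linked.map⁺ (Linked.map s≤s sorted)
    ; bounded = All.map⁺ (All.map s≤s bounded)
    }
    where open IncreasingSeq seq

  map-pred-increasing : ∀ {s} → IncreasingSeq (suc M) m s → IncreasingSeq M m (map pred s)
  map-pred-increasing {s} seq = record
    { length≡ = trans (List.length-map pred s) length≡
    ; sorted  = Linked.map⁺ (Linked.map pred-mono-≤ sorted)
    ; bounded = All.map⁺ (All.map pred-mono-≤ bounded)
    }
    where open IncreasingSeq seq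

  tail-increasing : ∀ {x s} → IncreasingSeq M (suc m) (x ∷ s) → IncreasingSeq M m s
  tail-increasing seq = record
    { length≡ = suc-injective length≡ ; sorted = Linked.tail sorted ; bounded = All.tail bounded }
    where open IncreasingSeq seq

map-suc∘pred : ∀ {s} → All (0 <_) s → map suc (map pred s) ≡ s
map-suc∘pred []              = refl
map-suc∘pred (s≤s z≤n ∷ s>0) = cong (_ ∷_) (map-suc∘pred s>0)

increasingSeqs-sound : ∀ M m → All (IncreasingSeq M m) (increasingSeqs M m)
increasingSeqs-sound M       zero    = record { length≡ = refl ; sorted = [] ; bounded = [] } ∷ []
increasingSeqs-sound zero    (suc m) = All.map⁺ (All.map 0∷-increasing (increasingSeqs-sound zero m))
increasingSeqs-sound (suc M) (suc m) = All.++⁺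
  (All.map⁺ (All.map 0∷-increasing (increasingSeqs-sound (suc M) m)))
  (All.map⁺ (All.map map-suc-increasing (increasingSeqs-sound M (suc m))))

increasingSeqs-complete : ∀ M m {s} → IncreasingSeq M m s → s ∈ increasingSeqs M m
increasingSeqs-complete M zero {[]} _ = here refl
increasingSeqs-complete zero (suc m) {zero ∷ s} seq =
  ∈-map⁺ (0 ∷_) (increasingSeqs-complete zero m (tail-increasing seq))
increasingSeqs-complete (suc M) (suc m) {zero ∷ s} seq =
  ∈-++⁺ˡ (∈-map⁺ (0 ∷_) (increasingSeqs-complete (suc M) m (tail-increasing seq)))
increasingSeqs-complete (suc M) (suc m) {s@(suc x ∷ _)} seq =
  subst (_∈ increasingSeqs (suc M) (suc m)) (map-suc∘pred s>0)
    (∈-++⁺ʳ _ (∈-map⁺ (map suc) (increasingSeqs-complete M (suc m) (map-pred-increasing seq))))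
  where
  s>0 : All (0 <_) s
  s>0 = Linked.Linked⇒All ≤-trans (s≤s z≤n) (IncreasingSeq.sorted seq)
increasingSeqs-complete zero (suc m) {suc x ∷ s} seq with IncreasingSeq.bounded seq
... | () ∷ _

increasingSeqs-unique : ∀ M m → Unique (increasingSeqs M m)
increasingSeqs-unique M       zero    = [] ∷ []
increasingSeqs-unique zero    (suc m) = Unique.map⁺ List.∷-injectiveʳ (increasingSeqs-unique zero m)
increasingSeqs-unique (suc M) (suc m) = Unique.++⁺
  (Unique.map⁺ List.∷-injectiveʳ (increasingSeqs-unique (suc M) m))
  (Unique.map⁺ (List.map-injective suc-injective) (increasingSeqs-unique M (suc m)))
  heads-differ
  where
  heads-differ : ∀ {s} → ¬ (s ∈ map (0 ∷_) (increasingSeqs (suc M) m)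
                          × s ∈ map (map suc) (increasingSeqs M (suc m)))
  heads-differ (s∈ˡ , s∈ʳ) with ∈-map⁻ (0 ∷_) s∈ˡ | ∈-map⁻ (map suc) s∈ʳ
  ... | u , _ , refl | t , t∈ , eq =
    0∷≢map-suc (IncreasingSeq.length≡ (All.lookup (increasingSeqs-sound M (suc m)) t∈)) eq
    where
    0∷≢map-suc : ∀ {t u} → length t ≡ suc m → 0 ∷ u ≢ map suc t
    0∷≢map-suc {_ ∷ _} _ ()

sum-map-suc : ∀ s → sum (map suc s) ≡ sum s + length s
sum-map-suc []      = refl
sum-map-suc (x ∷ s) = trans (cong (suc x +_) (sum-map-suc s))
  (trans (cong suc (sym (+-assoc x (sum s) (length s)))) (sym (+-suc (x + sum s) (length s))))

count-sum-increasingSeqs : ∀ M m d → count (λ s → sum s ≟ d) (increasingSeqs M m) ≡ gauss (M + m) m d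
count-sum-increasingSeqs M zero zero    = refl
count-sum-increasingSeqs M zero (suc d) = refl
count-sum-increasingSeqs zero (suc m) d = begin
  count (λ s → sum s ≟ d) (map (0 ∷_) (increasingSeqs zero m))
    ≡⟨ count-map _ (0 ∷_) (increasingSeqs zero m) ⟩
  count (λ s → sum s ≟ d) (increasingSeqs zero m)
    ≡⟨ count-sum-increasingSeqs zero m d ⟩
  gauss m m d
    ≡⟨ +-identityʳ (gauss m m d) ⟨
  gauss m m d + 0
    ≡⟨ cong (gauss m m d +_) (shift-zero (suc m) (gauss-vanishes (n<1+n m)) d) ⟨
  gauss m m d + shift (suc m) (gauss m (suc m)) d
    ∎
  where open ≡-Reasoning
count-sum-increasingSeqs (suc M) (suc m) d = begin
  count P? (map (0 ∷_) starting-0 ++ map (map suc) shifted)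
    ≡⟨ count-++ P? (map (0 ∷_) starting-0) _ ⟩
  count P? (map (0 ∷_) starting-0) + count P? (map (map suc) shifted)
    ≡⟨ cong₂ _+_ (count-map P? (0 ∷_) starting-0) (count-map P? (map suc) shifted) ⟩
  count P? starting-0 + count (λ s → sum (map suc s) ≟ d) shifted
    ≡⟨ cong₂ _+_ (count-sum-increasingSeqs (suc M) m d)
                 (count-≟-cong d (All.map sum-map-suc≡ (increasingSeqs-sound M (suc m)))) ⟩
  gauss (suc M + m) m d + count (λ s → sum s + suc m ≟ d) shifted
    ≡⟨ cong₂ _+_ (cong (λ n → gauss n m d) (sym (+-suc M m))) (count-+-shift sum (suc m) shifted d) ⟩
  gauss (M + suc m) m d + shift (suc m) (λ d′ → count (λ s → sum s ≟ d′) shifted) d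
    ≡⟨ cong (gauss (M + suc m) m d +_) (shift-cong (suc m) (count-sum-increasingSeqs M (suc m)) d) ⟩
  gauss (M + suc m) m d + shift (suc m) (gauss (M + suc m) (suc m)) d
    ∎
  where
  open ≡-Reasoning
  P? = λ s → sum s ≟ d
  starting-0 = increasingSeqs (suc M) m
  shifted    = increasingSeqs M (suc m)
  sum-map-suc≡ : ∀ {s} → IncreasingSeq M (suc m) s → sum (map suc s) ≡ sum s + suc m
  sum-map-suc≡ {s} seq = trans (sum-map-suc s) (cong (sum s +_) (IncreasingSeq.length≡ seq))

-- Lists whose entries differ by at most one

Balanced : List ℕ → Set
Balanced xs = ∀ {x y} → x ∈ xs → y ∈ xs → x ≤ suc y

balanced-resp-↭ : ∀ {xs ys} → xs ↭ ys → Balanced xs → Balanced ys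
balanced-resp-↭ xs↭ys bal x∈ y∈ =
  bal (Perm.∈-resp-↭ (↭-sym xs↭ys) x∈) (Perm.∈-resp-↭ (↭-sym xs↭ys) y∈)

AdjacentTo : ℕ → ℕ → Set
AdjacentTo a x = x ≡ a ⊎ x ≡ suc a

adjacentTo : ∀ {a x} → a ≤ x → x ≤ suc a → AdjacentTo a x
adjacentTo a≤x x≤1+a with m≤n⇒m<n∨m≡n x≤1+a
... | inj₁ (s≤s x≤a) = inj₁ (≤-antisym x≤a a≤x)
... | inj₂ x≡1+a     = inj₂ x≡1+a

balanced-within : ∀ {a xs} → All (λ x → a ≤ x × x ≤ suc a) xs → Balanced xs
balanced-within a≤xs≤1+a x∈ y∈ with All.lookup a≤xs≤1+a x∈ | All.lookup a≤xs≤1+a y∈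
... | _ , x≤1+a | a≤y , _ = ≤-trans x≤1+a (s≤s a≤y)

balanced⇒adjacent : ∀ x xs → Balanced (x ∷ xs) →
                    Σ[ a ∈ ℕ ] (a ∈ x ∷ xs × All (AdjacentTo a) (x ∷ xs))
balanced⇒adjacent x xs balanced =
  a , a∈ , All.tabulate (λ y∈ → adjacentTo (All.lookup a≤ y∈) (balanced y∈ a∈))
  where
  a = min x xs
  a∈ : a ∈ x ∷ xs
  a∈ with argmin-sel (λ y → y) x xs
  ... | inj₁ a≡x = here a≡x
  ... | inj₂ a∈xs = there a∈xs
  a≤ : All (a ≤_) (x ∷ xs)
  a≤ = min≤⊤ x xs ∷ min≤xs x xs

floor-unique : ∀ {L S a b} → L * a ≤ S → S < L * suc a → L * b ≤ S → S < L * suc b → a ≡ b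
floor-unique {L} lo hi lo′ hi′ = ≤-antisym (below lo hi′) (below lo′ hi)
  where
  below : ∀ {S a b} → L * a ≤ S → S < L * suc b → a ≤ b
  below lo hi = s≤s⁻¹ (*-cancelˡ-< L _ _ (≤-<-trans lo hi))

sum-replicate : ∀ n x → sum (replicate n x) ≡ n * x
sum-replicate zero    x = refl
sum-replicate (suc n) x = cong (x +_) (sum-replicate n x)

module _ (a : ℕ) where

  lows highs : List ℕ → ℕ
  lows  = count (_≟ a)
  highs = count (_≟ suc a)

  spread : ℕ → ℕ → List ℕ
  spread l h = replicate l a ++ replicate h (suc a)

  length-spread : ∀ l h → length (spread l h) ≡ l + h
  length-spread l h = trans (List.length-++ (replicate l a))
                            (cong₂ _+_ (List.length-replicate l) (List.length-replicate h))

  sum-spread : ∀ l h → sum (spread l h) ≡ (l + h) * a + h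
  sum-spread l h = begin
    sum (spread l h)             ≡⟨ sum-++ (replicate l a) _ ⟩
    sum (replicate l a) + sum (replicate h (suc a))
                                 ≡⟨ cong₂ _+_ (sum-replicate l a) (sum-replicate h (suc a)) ⟩
    l * a + h * suc a            ≡⟨ lemma l h a ⟩
    (l + h) * a + h              ∎
    where
    open ≡-Reasoning
    lemma : ∀ l h a → l * a + h * suc a ≡ (l + h) * a + h
    lemma = solve-∀

  adjacent-↭-spread : ∀ {xs} → All (AdjacentTo a) xs → xs ↭ spread (lows xs) (highs xs)
  adjacent-↭-spread [] = ↭-refl
  adjacent-↭-spread {_ ∷ xs} (inj₁ refl ∷ adj)
    rewrite count-accept (_≟ a) xs refl | count-reject (_≟ suc a) xs (λ a≡1+a → 1+n≢n (sym a≡1+a))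
    = prep a (adjacent-↭-spread adj)
  adjacent-↭-spread {_ ∷ xs} (inj₂ refl ∷ adj)
    rewrite count-reject (_≟ a) xs 1+n≢n | count-accept (_≟ suc a) xs refl
    = ↭-trans (prep (suc a) (adjacent-↭-spread adj))
              (↭-sym (Perm.shift (suc a) (replicate (lows xs) a) (replicate (highs xs) (suc a))))

  module _ {xs} (adj : All (AdjacentTo a) xs) where

    length-adjacent : length xs ≡ lows xs + highs xs
    length-adjacent = trans (Perm.↭-length (adjacent-↭-spread adj)) (length-spread (lows xs) (highs xs))

    sum-adjacent : sum xs ≡ length xs * a + highs xs
    sum-adjacent = begin
      sum xs                                  ≡⟨ sum-↭ (adjacent-↭-spread adj) ⟩
      sum (spread (lows xs) (highs xs))       ≡⟨ sum-spread (lows xs) (highs xs) ⟩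
      (lows xs + highs xs) * a + highs xs     ≡⟨ cong (λ L → L * a + highs xs) length-adjacent ⟨
      length xs * a + highs xs                ∎
      where open ≡-Reasoning

    floor-bounds : a ∈ xs → length xs * a ≤ sum xs × sum xs < length xs * suc a
    floor-bounds a∈ = subst (length xs * a ≤_) (sym sum-adjacent) (m≤m+n _ _) , (begin-strict
      sum xs                      ≡⟨ sum-adjacent ⟩
      length xs * a + highs xs    <⟨ +-monoʳ-< (length xs * a) highs<length ⟩
      length xs * a + length xs   ≡⟨ +-comm (length xs * a) (length xs) ⟩
      length xs + length xs * a   ≡⟨ *-suc (length xs) a ⟨
      length xs * suc a           ∎)
      where
      open ≤-Reasoning
      highs<length : highs xs < length xs
      highs<length = subst (highs xs <_) (sym length-adjacent)
        (subst (highs xs <_) (+-comm (highs xs) (lows xs))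
          (m<m+n (highs xs) (List.filter-some (_≟ a) (Any.map sym a∈))))

-- Both minima equal ⌊Σ / L⌋, and then the number of entries above the minimum is Σ − L ⌊Σ / L⌋.
adjacent-↭ : ∀ {a b xs ys} → a ∈ xs → All (AdjacentTo a) xs → b ∈ ys → All (AdjacentTo b) ys →
             length xs ≡ length ys → sum xs ≡ sum ys → xs ↭ ys
adjacent-↭ {a} {b} {xs} {ys} a∈ adj b∈ adj′ |xs|≡|ys| Σxs≡Σys with a≡b
  where
  a≡b : a ≡ b
  a≡b with lo , hi ← floor-bounds a adj a∈ | lo′ , hi′ ← floor-bounds b adj′ b∈ =
    floor-unique {length xs} lo hi (subst₂ _≤_ (cong (_* b) (sym |xs|≡|ys|)) (sym Σxs≡Σys) lo′)
                       (subst₂ _<_ (sym Σxs≡Σys) (cong (_* suc b) (sym |xs|≡|ys|)) hi′)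
... | refl = ↭-trans (adjacent-↭-spread a adj)
               (subst (_↭ ys) (cong₂ (spread a) (sym lows≡) (sym highs≡))
                      (↭-sym (adjacent-↭-spread a adj′)))
  where
  highs≡ : highs a xs ≡ highs a ys
  highs≡ = +-cancelˡ-≡ (length xs * a) _ _ (begin
    length xs * a + highs a xs   ≡⟨ sum-adjacent a adj ⟨
    sum xs                       ≡⟨ Σxs≡Σys ⟩
    sum ys                       ≡⟨ sum-adjacent a adj′ ⟩
    length ys * a + highs a ys   ≡⟨ cong (λ L → L * a + highs a ys) |xs|≡|ys| ⟨
    length xs * a + highs a ys   ∎)
    where open ≡-Reasoning
  lows≡ : lows a xs ≡ lows a ys
  lows≡ = +-cancelʳ-≡ (highs a xs) _ _ (begin
    lows a xs + highs a xs   ≡⟨ length-adjacent a adj ⟨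
    length xs                ≡⟨ |xs|≡|ys| ⟩
    length ys                ≡⟨ length-adjacent a adj′ ⟩
    lows a ys + highs a ys   ≡⟨ cong (lows a ys +_) highs≡ ⟨
    lows a ys + highs a xs   ∎)
    where open ≡-Reasoning

balanced-↭ : ∀ {xs ys} → length xs ≡ length ys → sum xs ≡ sum ys →
             Balanced xs → Balanced ys → xs ↭ ys
balanced-↭ {[]}     {[]}     _ _ _ _ = ↭-refl
balanced-↭ {x ∷ xs} {y ∷ ys} |xs|≡|ys| Σxs≡Σys bal-xs bal-ys
  with _ , a∈ , adj ← balanced⇒adjacent x xs bal-xs
     | _ , b∈ , adj′ ← balanced⇒adjacent y ys bal-ys
  = adjacent-↭ a∈ adj b∈ adj′ |xs|≡|ys| Σxs≡Σys

module _ (k : ℕ) .{{_ : NonZero k}} where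

  evenSplit : ℕ → List ℕ
  evenSplit S = spread (S / k) (k ∸ S % k) (S % k)

  private
    r≤k : ∀ S → S % k ≤ k
    r≤k S = <⇒≤ (m%n<n S k)

  length-evenSplit : ∀ S → length (evenSplit S) ≡ k
  length-evenSplit S = trans (length-spread (S / k) (k ∸ S % k) (S % k)) (m∸n+n≡m (r≤k S))

  sum-evenSplit : ∀ S → sum (evenSplit S) ≡ S
  sum-evenSplit S = begin
    sum (evenSplit S)                   ≡⟨ sum-spread (S / k) (k ∸ S % k) (S % k) ⟩
    (k ∸ S % k + S % k) * (S / k) + S % k ≡⟨ cong (λ n → n * (S / k) + S % k) (m∸n+n≡m (r≤k S)) ⟩
    k * (S / k) + S % k                 ≡⟨ cong (_+ S % k) (*-comm k (S / k)) ⟩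
    S / k * k + S % k                   ≡⟨ +-comm (S / k * k) (S % k) ⟩
    S % k + S / k * k                   ≡⟨ m≡m%n+[m/n]*n S k ⟨
    S                                   ∎
    where open ≡-Reasoning

  evenSplit-within : ∀ S → All (λ x → S / k ≤ x × x ≤ suc (S / k)) (evenSplit S)
  evenSplit-within S =
    All.++⁺ (All.replicate⁺ (k ∸ S % k) (≤-refl , n≤1+n _)) (All.replicate⁺ (S % k) (n≤1+n _ , ≤-refl))

  evenSplit-balanced : ∀ S → Balanced (evenSplit S)
  evenSplit-balanced S = balanced-within (evenSplit-within S)

  evenSplit-≥ : ∀ {c S} → c * k ≤ S → All (c ≤_) (evenSplit S)
  evenSplit-≥ {c} {S} ck≤S = All.map (λ (q≤x , _) → ≤-trans c≤q q≤x) (evenSplit-within S)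
    where
    c≤q : c ≤ S / k
    c≤q = subst (_≤ S / k) (m*n/n≡m c k) (/-monoˡ-≤ k ck≤S)

  evenSplit-≤ : ∀ {c S} → S ≤ c * k → All (_≤ c) (evenSplit S)
  evenSplit-≤ {c} {S} S≤ck = All.++⁺ (All.replicate⁺ _ q≤c) (replicate-nonempty⁺ (S % k) q<c)
    where
    q≤c : S / k ≤ c
    q≤c = subst (S / k ≤_) (m*n/n≡m c k) (/-monoˡ-≤ k S≤ck)
    q<c : 0 < S % k → S / k < c
    q<c r>0 = *-cancelʳ-< _ (S / k) c (begin-strict
      S / k * k           <⟨ m<n+m (S / k * k) r>0 ⟩
      S % k + S / k * k   ≡⟨ m≡m%n+[m/n]*n S k ⟨
      S                   ≤⟨ S≤ck ⟩
      c * k               ∎)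
      where open ≤-Reasoning
    replicate-nonempty⁺ : ∀ {P : ℕ → Set} {x} n → (0 < n → P x) → All P (replicate n x)
    replicate-nonempty⁺ zero    _  = []
    replicate-nonempty⁺ (suc n) Px = All.replicate⁺ (suc n) (Px (s≤s z≤n))

-- Modular diagrams as sorted lists of rows

module _ {B : ℕ} where

  radix-< : ∀ {m ℓ m′ ℓ′} → ℓ′ < B → m′ < m → m′ * B + ℓ′ < m * B + ℓ
  radix-< {m} {ℓ} {m′} {ℓ′} ℓ′<B m′<m = begin-strict
    m′ * B + ℓ′   <⟨ +-monoʳ-< (m′ * B) ℓ′<B ⟩
    m′ * B + B    ≡⟨ +-comm (m′ * B) B ⟩
    suc m′ * B    ≤⟨ *-monoˡ-≤ B m′<m ⟩
    m * B         ≤⟨ m≤m+n (m * B) ℓ ⟩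
    m * B + ℓ     ∎
    where open ≤-Reasoning

  radix-≤⇒≤ : ∀ {m ℓ m′ ℓ′} → ℓ < B → m′ * B + ℓ′ ≤ m * B + ℓ → m′ ≤ m
  radix-≤⇒≤ ℓ<B le = ≮⇒≥ (λ m<m′ → <⇒≱ (radix-< ℓ<B m<m′) le)

  radix-injective : ∀ {m ℓ m′ ℓ′} → ℓ < B → ℓ′ < B →
                    m′ * B + ℓ′ ≡ m * B + ℓ → m′ ≡ m × ℓ′ ≡ ℓ
  radix-injective {m} {ℓ} {m′} {ℓ′} ℓ<B ℓ′<B eq
    with refl ← ≤-antisym {m′} {m} (radix-≤⇒≤ ℓ<B (≤-reflexive eq))
                                   (radix-≤⇒≤ ℓ′<B (≤-reflexive (sym eq)))
    = refl , +-cancelˡ-≡ (m * B) _ _ eq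

module _ (_≟ᴮ_ : DecidableEquality B) (f : A → B) where

  private
    fibre : B → List A → List A
    fibre y = filter (λ x → f x ≟ᴮ y)

    fibre-∷-cancel : ∀ y {x xs ys} → fibre y (x ∷ xs) ↭ fibre y (x ∷ ys) → fibre y xs ↭ fibre y ys
    fibre-∷-cancel y {x} p with f x ≟ᴮ y
    ... | yes _ = Perm.drop-∷ p
    ... | no  _ = p

    head-∈ : ∀ {x xs ys} → fibre (f x) (x ∷ xs) ↭ fibre (f x) ys → x ∈ ys
    head-∈ {x} p = proj₁ (∈-filter⁻ (λ z → f z ≟ᴮ f x)
      (Perm.∈-resp-↭ (subst (_↭ _) (List.filter-accept (λ z → f z ≟ᴮ f x) refl) p) (here refl)))

  ↭-fibrewise : ∀ {xs ys} → (∀ y → filter (λ x → f x ≟ᴮ y) xs ↭ filter (λ x → f x ≟ᴮ y) ys) →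
                xs ↭ ys
  ↭-fibrewise {[]} {[]}     _      = ↭-refl
  ↭-fibrewise {[]} {y ∷ ys} fibres with () ← head-∈ {xs = ys} {[]} (↭-sym (fibres (f y)))
  ↭-fibrewise {x ∷ xs} {ys} fibres with ys₁ , ys₂ , refl ← ∈-∃++ (head-∈ {xs = xs} {ys} (fibres (f x))) =
    ↭-trans (prep x (↭-fibrewise (λ y → fibre-∷-cancel y (↭-trans (fibres y) (Perm.filter-↭ _ ys↭)))))
            (↭-sym ys↭)
    where
    ys↭ : ys₁ ++ [ x ] ++ ys₂ ↭ x ∷ ys₁ ++ ys₂
    ys↭ = Perm.shift x ys₁ ys₂

module _ {P : List ℕ → Set} {b} (D : Diagram b) where

  rows⁺ : (∀ i → P (row D i)) → All P (toList D)
  rows⁺ P-rows = VecAll.toList⁺ (VecAll.lookup⁻ P-rows)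

  rows⁻ : All P (toList D) → ∀ i → P (row D i)
  rows⁻ P-rows = VecAll.lookup⁺ (VecAll.toList⁻ P-rows)

module _ {R : A → A → Set p} where

  Linked-toList⁺ : ∀ {n} (v : Vec A n) → (∀ i j → toℕ i ≤ toℕ j → R (lookup v i) (lookup v j)) →
                   Linked R (toList v)
  Linked-toList⁺ Vec.[]                _ = []
  Linked-toList⁺ (x Vec.∷ Vec.[])      _ = [-]
  Linked-toList⁺ (x Vec.∷ y Vec.∷ v) mono =
    mono Fin.zero (Fin.suc Fin.zero) z≤n ∷
    Linked-toList⁺ (y Vec.∷ v) (λ i j i≤j → mono (Fin.suc i) (Fin.suc j) (s≤s i≤j))

  Linked-toList⁻ : (∀ {x} → R x x) → (∀ {x y z} → R x y → R y z → R x z) →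
                   ∀ {n} (v : Vec A n) → Linked R (toList v) →
                   ∀ i j → toℕ i ≤ toℕ j → R (lookup v i) (lookup v j)
  Linked-toList⁻ refl′ trans′ (x Vec.∷ v) linked Fin.zero Fin.zero _ = refl′
  Linked-toList⁻ refl′ trans′ (x Vec.∷ y Vec.∷ v) linked Fin.zero (Fin.suc j) _ =
    trans′ (Linked.head linked) (Linked-toList⁻ refl′ trans′ (y Vec.∷ v) (Linked.tail linked) Fin.zero j z≤n)
  Linked-toList⁻ refl′ trans′ (x Vec.∷ v) linked (Fin.suc i) (Fin.suc j) (s≤s i≤j) =
    Linked-toList⁻ refl′ trans′ v (Linked.tail linked) i j i≤j

rowLabel-∈ : ∀ r → 0 < length r → rowLabel r ∈ r
rowLabel-∈ (x ∷ [])    _ = here refl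
rowLabel-∈ (x ∷ y ∷ r) _ = there (rowLabel-∈ (y ∷ r) (s≤s z≤n))

cell-rowLen : ∀ r → 0 < length r → cell r (rowLen r) ≡ just (rowLabel r)
cell-rowLen (x ∷ [])    _ = refl
cell-rowLen (x ∷ y ∷ r) _ = cell-rowLen (y ∷ r) (s≤s z≤n)

module Rows (N : ℕ) where

  mkRow : ℕ → ℕ → List ℕ
  mkRow m ℓ = replicate m N ++ [ ℓ ]

  length-mkRow : ∀ m ℓ → length (mkRow m ℓ) ≡ suc m
  length-mkRow zero    ℓ = refl
  length-mkRow (suc m) ℓ = cong suc (length-mkRow m ℓ)

  rowLen-mkRow : ∀ m ℓ → rowLen (mkRow m ℓ) ≡ m
  rowLen-mkRow m ℓ = cong (_∸ 1) (length-mkRow m ℓ)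

  rowLabel-mkRow : ∀ m ℓ → rowLabel (mkRow m ℓ) ≡ ℓ
  rowLabel-mkRow zero          ℓ = refl
  rowLabel-mkRow (suc zero)    ℓ = refl
  rowLabel-mkRow (suc (suc m)) ℓ = rowLabel-mkRow (suc m) ℓ

  cell-mkRow-< : ∀ {m c} ℓ → c < m → cell (mkRow m ℓ) c ≡ just N
  cell-mkRow-< {suc m} {zero}  ℓ _         = refl
  cell-mkRow-< {suc m} {suc c} ℓ (s≤s c<m) = cell-mkRow-< ℓ c<m

  cell-mkRow : ∀ m ℓ c {x} → cell (mkRow m ℓ) c ≡ just x → (c < m × x ≡ N) ⊎ (c ≡ m × x ≡ ℓ)
  cell-mkRow zero    ℓ zero    refl = inj₂ (refl , refl)
  cell-mkRow (suc m) ℓ zero    refl = inj₁ (s≤s z≤n , refl)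
  cell-mkRow (suc m) ℓ (suc c) eq with cell-mkRow m ℓ c eq
  ... | inj₁ (c<m , x≡N) = inj₁ (s≤s c<m , x≡N)
  ... | inj₂ (c≡m , x≡ℓ) = inj₂ (cong suc c≡m , x≡ℓ)

  ≡-mkRow : ∀ r → 0 < length r → (∀ c → c < rowLen r → cell r c ≡ just N) →
            r ≡ mkRow (rowLen r) (rowLabel r)
  ≡-mkRow (x ∷ [])    _ _     = refl
  ≡-mkRow (x ∷ y ∷ r) _ inner = cong₂ _∷_ (Maybe.just-injective (inner 0 (s≤s z≤n)))
    (≡-mkRow (y ∷ r) (s≤s z≤n) (λ c c<n → inner (suc c) (s≤s c<n)))

  -- Since labels are at most N, comparing keys compares rows lexicographically by (length, label).
  key : List ℕ → ℕ
  key r = rowLen r * suc N + rowLabel r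

  key-mkRow : ∀ m ℓ → key (mkRow m ℓ) ≡ m * suc N + ℓ
  key-mkRow m ℓ = cong₂ (λ m ℓ → m * suc N + ℓ) (rowLen-mkRow m ℓ) (rowLabel-mkRow m ℓ)

  Descending : List (List ℕ) → Set
  Descending = Linked (λ r r′ → key r′ ≤ key r)

  data Canonical : List ℕ → Set where
    mkRow⁺ : ∀ m {ℓ} → ℓ ≤ N → Canonical (mkRow m ℓ)

  canonical-label≤ : ∀ {r} → Canonical r → rowLabel r ≤ N
  canonical-label≤ (mkRow⁺ m {ℓ} ℓ≤N) = subst (_≤ N) (sym (rowLabel-mkRow m ℓ)) ℓ≤N

  mkRow-rowLen : ∀ {r ℓ} → Canonical r → rowLabel r ≡ ℓ → mkRow (rowLen r) ℓ ≡ r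
  mkRow-rowLen (mkRow⁺ m {ℓ} _) refl = cong₂ mkRow (rowLen-mkRow m ℓ) (rowLabel-mkRow m ℓ)

  map-key-injective : ∀ {xs ys} → All Canonical xs → All Canonical ys → map key xs ≡ map key ys → xs ≡ ys
  map-key-injective [] [] _ = refl
  map-key-injective (mkRow⁺ m {ℓ} ℓ≤N ∷ cxs) (mkRow⁺ m′ {ℓ′} ℓ′≤N ∷ cys) eq
    with refl , refl ← radix-injective {suc N} {m′} {ℓ′} {m} {ℓ} (s≤s ℓ′≤N) (s≤s ℓ≤N)
                         (trans (sym (key-mkRow m ℓ)) (trans (List.∷-injectiveˡ eq) (key-mkRow m′ ℓ′)))
    = cong (_ ∷_) (map-key-injective cxs cys (List.∷-injectiveʳ eq))

  descending-↭⇒≡ : ∀ {xs ys} → All Canonical xs → All Canonical ys →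
                   Descending xs → Descending ys → xs ↭ ys → xs ≡ ys
  descending-↭⇒≡ cxs cys dxs dys xs↭ys =
    map-key-injective cxs cys (Pointwise.Pointwise-≡⇒≡ (Pointwise.map sym
    (↗↭↗⇒≋ ≥-totalOrder (Linked.map⁺ dxs) (Linked.map⁺ dys)
      (↭⇒↭ₛ′ (TotalOrder.isEquivalence ≥-totalOrder) (Perm.map⁺ key xs↭ys)))))
    where
    ≥-totalOrder = Flip.totalOrder ≤-totalOrder

  module _ {b} {D : Diagram b} (modular : IsModular N b D) where
    open IsModular modular

    rowLabel-range : ∀ i → 1 ≤ rowLabel (row D i) × rowLabel (row D i) ≤ N
    rowLabel-range i = All.lookup (labelRange i) (rowLabel-∈ (row D i) (nonempty i))

    rows-canonical : All Canonical (toList D)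
    rows-canonical = rows⁺ D λ i →
      subst Canonical (sym (≡-mkRow (row D i) (nonempty i) (innerN i))) (mkRow⁺ _ (proj₂ (rowLabel-range i)))

    -- Rows of equal length end in the same column, where the labels decrease downwards.
    rows-descending : Descending (toList D)
    rows-descending = Linked-toList⁺ D key-antitone
      where
      key-antitone : ∀ i j → toℕ i ≤ toℕ j → key (row D j) ≤ key (row D i)
      key-antitone i j i≤j with m≤n⇒m<n∨m≡n (partition i j i≤j)
      ... | inj₁ shorter    = <⇒≤ (radix-< (s≤s (proj₂ (rowLabel-range j))) shorter)
      ... | inj₂ same-length =
        subst (λ m → m * suc N + rowLabel (row D j) ≤ key (row D i)) (sym same-length)
          (+-monoʳ-≤ (rowLen (row D i) * suc N)
            (columns i j i≤j _ _ _ (cell-rowLen (row D i) (nonempty i))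
              (subst (λ c → cell (row D j) c ≡ just (rowLabel (row D j))) same-length
                     (cell-rowLen (row D j) (nonempty j)))))

  module _ {r r′ : List ℕ} where

    canonical-rowLen-≤ : Canonical r → Canonical r′ → key r′ ≤ key r → rowLen r′ ≤ rowLen r
    canonical-rowLen-≤ (mkRow⁺ m {ℓ} ℓ≤N) (mkRow⁺ m′ {ℓ′} _) key≤ =
      subst₂ _≤_ (sym (rowLen-mkRow m′ ℓ′)) (sym (rowLen-mkRow m ℓ))
        (radix-≤⇒≤ (s≤s ℓ≤N) (subst₂ _≤_ (key-mkRow m′ ℓ′) (key-mkRow m ℓ) key≤))

    canonical-column-≤ : Canonical r → Canonical r′ → key r′ ≤ key r →
                         ∀ c x y → cell r c ≡ just x → cell r′ c ≡ just y → y ≤ x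
    canonical-column-≤ (mkRow⁺ m {ℓ} ℓ≤N) (mkRow⁺ m′ {ℓ′} ℓ′≤N) key≤ c _ _ cell≡x cell′≡y
      with cell-mkRow m ℓ c cell≡x | cell-mkRow m′ ℓ′ c cell′≡y
    ... | inj₁ (_ , refl)       | inj₁ (_ , refl)    = ≤-refl
    ... | inj₁ (_ , refl)       | inj₂ (_ , refl)    = ℓ′≤N
    ... | inj₂ (refl , _)       | inj₁ (c<m′ , _)    =
      contradiction (radix-≤⇒≤ (s≤s ℓ≤N) keys≤) (<⇒≱ c<m′)
      where keys≤ = subst₂ _≤_ (key-mkRow m′ ℓ′) (key-mkRow m ℓ) key≤
    ... | inj₂ (refl , refl)    | inj₂ (refl , refl) =
      +-cancelˡ-≤ (c * suc N) _ _ (subst₂ _≤_ (key-mkRow m′ ℓ′) (key-mkRow m ℓ) key≤)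

  canonical-labels : ∀ {r} → Canonical r → 1 ≤ rowLabel r → All (λ x → 1 ≤ x × x ≤ N) r
  canonical-labels (mkRow⁺ m {ℓ} ℓ≤N) 1≤label =
    All.++⁺ (All.replicate⁺ m (≤-trans 1≤ℓ ℓ≤N , ≤-refl)) ((1≤ℓ , ℓ≤N) ∷ [])
    where
    1≤ℓ : 1 ≤ ℓ
    1≤ℓ = subst (1 ≤_) (rowLabel-mkRow m ℓ) 1≤label

  canonical-inner : ∀ {r} → Canonical r → ∀ c → c < rowLen r → cell r c ≡ just N
  canonical-inner (mkRow⁺ m {ℓ} _) c c<len = cell-mkRow-< ℓ (subst (c <_) (rowLen-mkRow m ℓ) c<len)

  canonical-nonempty : ∀ {r} → Canonical r → 0 < length r
  canonical-nonempty (mkRow⁺ m {ℓ} _) = subst (0 <_) (sym (length-mkRow m ℓ)) (s≤s z≤n)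

  canonical-descending⇒modular : ∀ {b} (D : Diagram b) → All Canonical (toList D) →
    All (λ r → 1 ≤ rowLabel r) (toList D) → Descending (toList D) → IsModular N b D
  canonical-descending⇒modular D canonical labels≥1 descending = record
    { nonempty   = λ i → canonical-nonempty (canonical′ i)
    ; partition  = λ i j i≤j → canonical-rowLen-≤ (canonical′ i) (canonical′ j) (key-antitone i j i≤j)
    ; labelRange = λ i → canonical-labels (canonical′ i) (rows⁻ D labels≥1 i)
    ; innerN     = λ i → canonical-inner (canonical′ i)
    ; columns    = λ i j i≤j → canonical-column-≤ (canonical′ i) (canonical′ j) (key-antitone i j i≤j)
    }
    where
    canonical′ = rows⁻ D canonical
    key-antitone : ∀ i j → toℕ i ≤ toℕ j → key (row D j) ≤ key (row D i)
    key-antitone = Linked-toList⁻ ≤-refl (λ r≥s s≥t → ≤-trans s≥t r≥s) D descending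

-- Good diagrams are determined by their label sums

module _ {b} (D : Diagram b) where

  labelledRows : ℕ → List (List ℕ)
  labelledRows ℓ = filter (λ r → rowLabel r ≟ ℓ) (toList D)

  labelledLengths : ℕ → List ℕ
  labelledLengths ℓ = map rowLen (labelledRows ℓ)

  ∈-rows : ∀ {r} → r ∈ toList D → Σ[ i ∈ Fin b ] r ≡ row D i
  ∈-rows r∈ = VecAny.index r∈′ , VecAny.lookup-index r∈′
    where r∈′ = ∈-toList⁻ r∈

  ∈-labelledLengths : ∀ i → rowLen (row D i) ∈ labelledLengths (rowLabel (row D i))
  ∈-labelledLengths i = ∈-map⁺ rowLen (∈-filter⁺ (λ r → rowLabel r ≟ _) (∈-toList⁺ (∈-lookup i D)) refl)

  spread≤1⇒balanced : (∀ i j → rowLabel (row D i) ≡ rowLabel (row D j) →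
                                rowLen (row D i) ≤ rowLen (row D j) + 1) →
                      ∀ ℓ → Balanced (labelledLengths ℓ)
  spread≤1⇒balanced spread≤1 ℓ x∈ y∈
    with r , r∈ , refl ← ∈-map⁻ rowLen x∈ | s , s∈ , refl ← ∈-map⁻ rowLen y∈
    with r∈D , refl    ← ∈-filter⁻ (λ r → rowLabel r ≟ ℓ) r∈
       | s∈D , s-label ← ∈-filter⁻ (λ r → rowLabel r ≟ ℓ) s∈
    with i , refl ← ∈-rows r∈D | j , refl ← ∈-rows s∈D
    = subst (rowLen (row D i) ≤_) (+-comm (rowLen (row D j)) 1) (spread≤1 i j (sym s-label))

  balanced⇒spread≤1 : (∀ i → Balanced (labelledLengths (rowLabel (row D i)))) →
                      ∀ i j → rowLabel (row D i) ≡ rowLabel (row D j) →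
                              rowLen (row D i) ≤ rowLen (row D j) + 1
  balanced⇒spread≤1 balanced i j same-label =
    subst (rowLen (row D i) ≤_) (+-comm 1 (rowLen (row D j)))
      (balanced i (∈-labelledLengths i)
        (subst (λ ℓ → rowLen (row D j) ∈ labelledLengths ℓ) (sym same-label) (∈-labelledLengths j)))

module _ {a b k N : ℕ} where
  open Rows N

  module _ {D : Diagram b} (good : Good a b k N D) where
    open Good good

    labelledRows-≡ : ∀ ℓ → map (λ m → mkRow m ℓ) (labelledLengths D ℓ) ≡ labelledRows D ℓ
    labelledRows-≡ ℓ = trans (sym (List.map-∘ (labelledRows D ℓ))) (List.map-id-local
      (All.zipWith (λ (canonical , label≡ℓ) → mkRow-rowLen canonical label≡ℓ)
        (All.filter⁺ _ (rows-canonical modular) , All.all-filter _ (toList D))))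

    labelledRows-outside : ∀ {ℓ} → ¬ (1 ≤ ℓ × ℓ ≤ N) → labelledRows D ℓ ≡ []
    labelledRows-outside outside = List.filter-none _
      (All.map (λ range label≡ℓ → outside (subst (λ ℓ → 1 ≤ ℓ × ℓ ≤ N) label≡ℓ range))
        (rows⁺ D (rowLabel-range modular)))

    length-labelledLengths : ∀ {ℓ} → 1 ≤ ℓ → ℓ ≤ N → length (labelledLengths D ℓ) ≡ k
    length-labelledLengths 1≤ℓ ℓ≤N = trans (List.length-map rowLen (labelledRows D _)) (cond1 _ 1≤ℓ ℓ≤N)

  good-unique : ∀ {D D′ : Diagram b} → Good a b k N D → Good a b k N D′ →
                (∀ ℓ → 1 ≤ ℓ → ℓ ≤ N → labelSum D ℓ ≡ labelSum D′ ℓ) → D ≡ D′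
  good-unique {D} {D′} good good′ Σ≡ =
    trans (sym (cast-is-id refl D)) (toList-injective refl D D′ (descending-↭⇒≡
    (rows-canonical (Good.modular good)) (rows-canonical (Good.modular good′))
    (rows-descending (Good.modular good)) (rows-descending (Good.modular good′))
    (↭-fibrewise _≟_ rowLabel labelledRows-↭)))
    where
    labelledRows-↭ : ∀ ℓ → labelledRows D ℓ ↭ labelledRows D′ ℓ
    labelledRows-↭ ℓ with (1 ≤? ℓ) ×-dec (ℓ ≤? N)
    ... | no outside = ↭-reflexive
      (trans (labelledRows-outside good outside) (sym (labelledRows-outside good′ outside)))
    ... | yes (1≤ℓ , ℓ≤N) = begin
      labelledRows D ℓ                              ≡⟨ labelledRows-≡ good ℓ ⟨
      map (λ m → mkRow m ℓ) (labelledLengths D ℓ)   ↭⟨ Perm.map⁺ _ (balanced-↭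
          (trans (length-labelledLengths good 1≤ℓ ℓ≤N) (sym (length-labelledLengths good′ 1≤ℓ ℓ≤N)))
          (Σ≡ ℓ 1≤ℓ ℓ≤N)
          (spread≤1⇒balanced D (Good.cond4 good) ℓ) (spread≤1⇒balanced D′ (Good.cond4 good′) ℓ)) ⟩
      map (λ m → mkRow m ℓ) (labelledLengths D′ ℓ)  ≡⟨ labelledRows-≡ good′ ℓ ⟩
      labelledRows D′ ℓ                             ∎
      where open PermutationReasoning

-- Good diagrams from weakly increasing sequences

nth : List ℕ → ℕ → ℕ
nth []      i       = 0
nth (x ∷ s) zero    = x
nth (x ∷ s) (suc i) = nth s i

nth-∈ : ∀ {s i} → i < length s → nth s i ∈ s
nth-∈ {x ∷ s} {zero}  _         = here refl
nth-∈ {x ∷ s} {suc i} (s≤s i<n) = there (nth-∈ i<n)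

nth-mono : ∀ {s i} → Linked _≤_ s → suc i < length s → nth s i ≤ nth s (suc i)
nth-mono {x ∷ y ∷ s} {zero}  (x≤y ∷ _)    _           = x≤y
nth-mono {x ∷ y ∷ s} {suc i} (_ ∷ sorted) (s≤s i+1<n) = nth-mono sorted i+1<n
nth-mono {x ∷ []}    {zero}  [-]          (s≤s ())

nth-applyUpTo : ∀ f {n i} → i < n → nth (applyUpTo f n) i ≡ f i
nth-applyUpTo f {suc n} {zero}  _         = refl
nth-applyUpTo f {suc n} {suc i} (s≤s i<n) = nth-applyUpTo (λ j → f (suc j)) i<n

applyUpTo-nth : ∀ f {s} → (∀ {i} → i < length s → f i ≡ nth s i) → applyUpTo f (length s) ≡ s
applyUpTo-nth f {[]}    _    = refl
applyUpTo-nth f {x ∷ s} f≡s =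
  cong₂ _∷_ (f≡s (s≤s z≤n)) (applyUpTo-nth (λ j → f (suc j)) (λ i<n → f≡s (s≤s i<n)))

length*≤sum : ∀ {c xs} → All (c ≤_) xs → c * length xs ≤ sum xs
length*≤sum {c} {[]}     []          = ≤-reflexive (*-zeroʳ c)
length*≤sum {c} {x ∷ xs} (c≤x ∷ c≤xs) =
  subst (_≤ x + sum xs) (sym (*-suc c (length xs))) (+-mono-≤ c≤x (length*≤sum c≤xs))

-- Pads with empty rows; it is only applied to lists of exactly n rows.
toDiagram : (n : ℕ) → List (List ℕ) → Diagram n
toDiagram zero    _        = Vec.[]
toDiagram (suc n) []       = [] Vec.∷ toDiagram n []
toDiagram (suc n) (r ∷ rs) = r Vec.∷ toDiagram n rs

toList-toDiagram : ∀ n rs → length rs ≡ n → toList (toDiagram n rs) ≡ rs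
toList-toDiagram zero    []       _  = refl
toList-toDiagram (suc n) (r ∷ rs) eq = cong (r ∷_) (toList-toDiagram n rs (suc-injective eq))

SizeEnumeration : ∀ {b} → (Diagram b → Set) → (ℕ → ℕ) → Set
SizeEnumeration {b} P f =
  Σ[ L ∈ List (Diagram b) ]
    (Unique L × (∀ D → (D ∈ L) ⇔ P D) × (∀ d → length (filter (λ D → size D ≟ d) L) ≡ f d))

module Construction (a N′ k′ : ℕ) where

  N = suc N′
  k = suc k′
  b = N * k
  -- the least label sum allowed by condition (3): k rows of length N − 1
  base = N′ * k

  open Rows N

  block : ℕ → ℕ → List (List ℕ)
  block ℓ S = map (λ m → mkRow m ℓ) (evenSplit k S)

  blocks : ℕ → List ℕ → List (List ℕ)
  blocks ℓ []      = []
  blocks ℓ (x ∷ s) = block ℓ (base + x) ++ blocks (suc ℓ) s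

  rowLens-block : ∀ ℓ S → map rowLen (block ℓ S) ≡ evenSplit k S
  rowLens-block ℓ S = trans (sym (List.map-∘ (evenSplit k S)))
    (trans (List.map-cong (λ m → rowLen-mkRow m ℓ) (evenSplit k S)) (List.map-id (evenSplit k S)))

  length-block : ∀ ℓ S → length (block ℓ S) ≡ k
  length-block ℓ S = trans (List.length-map _ (evenSplit k S)) (length-evenSplit k S)

  labels-block : ∀ ℓ S → All (λ r → rowLabel r ≡ ℓ) (block ℓ S)
  labels-block ℓ S = All.map⁺ (All.universal (λ m → rowLabel-mkRow m ℓ) (evenSplit k S))

  All-blocks : ∀ {P : List ℕ → Set} ℓ₀ s →
               (∀ {ℓ x} → ℓ₀ ≤ ℓ → ℓ < ℓ₀ + length s → x ∈ s → All P (block ℓ (base + x))) →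
               All P (blocks ℓ₀ s)
  All-blocks ℓ₀ []      _ = []
  All-blocks ℓ₀ (x ∷ s) P-block = All.++⁺
    (P-block ≤-refl (m<m+n ℓ₀ (s≤s z≤n)) (here refl))
    (All-blocks (suc ℓ₀) s (λ {ℓ} ℓ₀<ℓ ℓ<end x∈ →
      P-block (<⇒≤ ℓ₀<ℓ) (subst (ℓ <_) (sym (+-suc ℓ₀ (length s))) ℓ<end) (there x∈)))

  labels-blocks : ∀ ℓ₀ s → All (λ r → ℓ₀ ≤ rowLabel r) (blocks ℓ₀ s)
  labels-blocks ℓ₀ s = All-blocks ℓ₀ s λ {ℓ} {x} ℓ₀≤ℓ _ _ →
    All.map (λ label≡ℓ → subst (ℓ₀ ≤_) (sym label≡ℓ) ℓ₀≤ℓ) (labels-block ℓ (base + x))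

  filter-blocks : ∀ {ℓ ℓ₀} s → ℓ₀ ≤ ℓ → ℓ < ℓ₀ + length s →
                  filter (λ r → rowLabel r ≟ ℓ) (blocks ℓ₀ s) ≡ block ℓ (base + nth s (ℓ ∸ ℓ₀))
  filter-blocks {ℓ} {ℓ₀} [] ℓ₀≤ℓ ℓ<ℓ₀+0 =
    contradiction ℓ₀≤ℓ (<⇒≱ (subst (ℓ <_) (+-identityʳ ℓ₀) ℓ<ℓ₀+0))
  filter-blocks {ℓ} {ℓ₀} (x ∷ s) ℓ₀≤ℓ ℓ<end with ℓ₀ ≟ ℓ
  ... | yes refl = begin
    filter P? (block ℓ (base + x) ++ blocks (suc ℓ) s)
      ≡⟨ List.filter-++ P? (block ℓ (base + x)) _ ⟩
    filter P? (block ℓ (base + x)) ++ filter P? (blocks (suc ℓ) s)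
      ≡⟨ cong₂ _++_ (List.filter-all P? (labels-block ℓ (base + x)))
                    (List.filter-none P? (All.map (λ ℓ<label label≡ℓ → <⇒≢ ℓ<label (sym label≡ℓ))
                                                  (labels-blocks (suc ℓ) s))) ⟩
    block ℓ (base + x) ++ []
      ≡⟨ List.++-identityʳ _ ⟩
    block ℓ (base + x)
      ≡⟨ cong (λ i → block ℓ (base + nth (x ∷ s) i)) (n∸n≡0 ℓ) ⟨
    block ℓ (base + nth (x ∷ s) (ℓ ∸ ℓ))
      ∎
    where
    open ≡-Reasoning
    P? = λ r → rowLabel r ≟ ℓ
  ... | no ℓ₀≢ℓ = begin
    filter P? (block ℓ₀ (base + x) ++ blocks (suc ℓ₀) s)
      ≡⟨ List.filter-++ P? (block ℓ₀ (base + x)) _ ⟩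
    filter P? (block ℓ₀ (base + x)) ++ filter P? (blocks (suc ℓ₀) s)
      ≡⟨ cong (_++ filter P? (blocks (suc ℓ₀) s))
              (List.filter-none P? (All.map (λ label≡ℓ₀ label≡ℓ → ℓ₀≢ℓ (trans (sym label≡ℓ₀) label≡ℓ))
                                            (labels-block ℓ₀ (base + x)))) ⟩
    filter P? (blocks (suc ℓ₀) s)
      ≡⟨ filter-blocks s ℓ₀<ℓ (subst (ℓ <_) (+-suc ℓ₀ (length s)) ℓ<end) ⟩
    block ℓ (base + nth s (ℓ ∸ suc ℓ₀))
      ≡⟨ cong (λ i → block ℓ (base + nth (x ∷ s) i)) (+-∸-assoc 1 ℓ₀<ℓ) ⟨
    block ℓ (base + nth (x ∷ s) (ℓ ∸ ℓ₀))
      ∎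
    where
    open ≡-Reasoning
    P? = λ r → rowLabel r ≟ ℓ
    ℓ₀<ℓ = ≤∧≢⇒< ℓ₀≤ℓ ℓ₀≢ℓ

  length-blocks : ∀ ℓ s → length (blocks ℓ s) ≡ length s * k
  length-blocks ℓ []      = refl
  length-blocks ℓ (x ∷ s) = trans (List.length-++ (block ℓ (base + x)))
                                  (cong₂ _+_ (length-block ℓ (base + x)) (length-blocks (suc ℓ) s))

  sum-rowLens-blocks : ∀ ℓ s → sum (map rowLen (blocks ℓ s)) ≡ sum s + length s * base
  sum-rowLens-blocks ℓ []      = refl
  sum-rowLens-blocks ℓ (x ∷ s) = begin
    sum (map rowLen (block ℓ (base + x) ++ blocks (suc ℓ) s))
      ≡⟨ cong sum (List.map-++ rowLen (block ℓ (base + x)) _) ⟩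
    sum (map rowLen (block ℓ (base + x)) ++ map rowLen (blocks (suc ℓ) s))
      ≡⟨ sum-++ (map rowLen (block ℓ (base + x))) _ ⟩
    sum (map rowLen (block ℓ (base + x))) + sum (map rowLen (blocks (suc ℓ) s))
      ≡⟨ cong₂ _+_ (trans (cong sum (rowLens-block ℓ (base + x))) (sum-evenSplit k (base + x)))
                   (sum-rowLens-blocks (suc ℓ) s) ⟩
    base + x + (sum s + length s * base)
      ≡⟨ lemma base x (sum s) (length s) ⟩
    x + sum s + suc (length s) * base
      ∎
    where
    open ≡-Reasoning
    lemma : ∀ base x Σ L → base + x + (Σ + L * base) ≡ x + Σ + suc L * base
    lemma = solve-∀

  open Data.List.Sort (On.decTotalOrder (Flip.decTotalOrder ≤-decTotalOrder) key) using (sort; sort-↭; sort-↗)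

  diagramOf : List ℕ → Diagram b
  diagramOf s = toDiagram b (sort (blocks 1 s))

  record RowBounds (r : List ℕ) : Set where
    field
      canonical : Canonical r
      label≥1   : 1 ≤ rowLabel r
      length≥   : N′ ≤ rowLen r
      length≤   : rowLen r ≤ a

  module _ {M : ℕ} (M-bound : base + M + b ≡ k * (a + 1)) {s : List ℕ} (seq : IncreasingSeq M N s) where
    open IncreasingSeq seq

    private
      D = diagramOf s

    toList-diagramOf : toList D ≡ sort (blocks 1 s)
    toList-diagramOf = toList-toDiagram b _
      (trans (Perm.↭-length (sort-↭ (blocks 1 s))) (trans (length-blocks 1 s) (cong (_* k) length≡)))

    diagramOf-↭ : toList D ↭ blocks 1 s
    diagramOf-↭ = subst (_↭ blocks 1 s) (sym toList-diagramOf) (sort-↭ (blocks 1 s))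

    diagramOf-descending : Descending (toList D)
    diagramOf-descending = subst Descending (sym toList-diagramOf) (sort-↗ (blocks 1 s))

    blocks-rowBounds : All RowBounds (blocks 1 s)
    blocks-rowBounds = All-blocks 1 s λ {ℓ} {x} 1≤ℓ ℓ<1+length x∈ →
      let ℓ≤N = s≤s⁻¹ (subst (ℓ <_) (cong suc length≡) ℓ<1+length) in
      All.map⁺ (All.zipWith (λ (N′≤m , m≤a) → bounds ℓ≤N 1≤ℓ N′≤m m≤a)
        (evenSplit-≥ k (m≤m+n base x) , evenSplit-≤ k (base+x≤a*k (All.lookup bounded x∈))))
      where
      bounds : ∀ {ℓ m} → ℓ ≤ N → 1 ≤ ℓ → N′ ≤ m → m ≤ a → RowBounds (mkRow m ℓ)
      bounds {ℓ} {m} ℓ≤N 1≤ℓ N′≤m m≤a = record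
        { canonical = mkRow⁺ m ℓ≤N
        ; label≥1   = subst (1 ≤_) (sym (rowLabel-mkRow m ℓ)) 1≤ℓ
        ; length≥   = subst (N′ ≤_) (sym (rowLen-mkRow m ℓ)) N′≤m
        ; length≤   = subst (_≤ a) (sym (rowLen-mkRow m ℓ)) m≤a
        }
      base+x≤a*k : ∀ {x} → x ≤ M → base + x ≤ a * k
      base+x≤a*k {x} x≤M = +-cancelʳ-≤ k (base + x) (a * k) (begin
        base + x + k    ≤⟨ +-mono-≤ (+-monoʳ-≤ base x≤M) (m≤m+n k (N′ * k)) ⟩
        base + M + b    ≡⟨ M-bound ⟩
        k * (a + 1)     ≡⟨ lemma k a ⟩
        a * k + k       ∎)
        where
        open ≤-Reasoning
        lemma : ∀ k a → k * (a + 1) ≡ a * k + k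
        lemma = solve-∀

    diagramOf-rowBounds : ∀ i → RowBounds (row D i)
    diagramOf-rowBounds = rows⁻ D (Perm.All-resp-↭ (↭-sym diagramOf-↭) blocks-rowBounds)

    labelledLengths-diagramOf : ∀ {ℓ} → 1 ≤ ℓ → ℓ ≤ N →
                                labelledLengths D ℓ ↭ evenSplit k (base + nth s (ℓ ∸ 1))
    labelledLengths-diagramOf {ℓ} 1≤ℓ ℓ≤N = begin
      map rowLen (filter P? (toList D))     ↭⟨ Perm.map⁺ rowLen (Perm.filter-↭ P? diagramOf-↭) ⟩
      map rowLen (filter P? (blocks 1 s))
        ≡⟨ cong (map rowLen) (filter-blocks s 1≤ℓ (s≤s (subst (ℓ ≤_) (sym length≡) ℓ≤N))) ⟩
      map rowLen (block ℓ (base + nth s (ℓ ∸ 1)))  ≡⟨ rowLens-block ℓ (base + nth s (ℓ ∸ 1)) ⟩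
      evenSplit k (base + nth s (ℓ ∸ 1))    ∎
      where
      open PermutationReasoning
      P? = λ r → rowLabel r ≟ ℓ

    labelSum-diagramOf : ∀ {ℓ} → 1 ≤ ℓ → ℓ ≤ N → labelSum D ℓ ≡ base + nth s (ℓ ∸ 1)
    labelSum-diagramOf {ℓ} 1≤ℓ ℓ≤N =
      trans (sum-↭ (labelledLengths-diagramOf 1≤ℓ ℓ≤N)) (sum-evenSplit k (base + nth s (ℓ ∸ 1)))

    size-diagramOf : size D ≡ sum s + N * base
    size-diagramOf = begin
      sum (map rowLen (toList D))      ≡⟨ sum-↭ (Perm.map⁺ rowLen diagramOf-↭) ⟩
      sum (map rowLen (blocks 1 s))    ≡⟨ sum-rowLens-blocks 1 s ⟩
      sum s + length s * base          ≡⟨ cong (λ n → sum s + n * base) length≡ ⟩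
      sum s + N * base                 ∎
      where open ≡-Reasoning

    diagramOf-good : Good a b k N D
    diagramOf-good = record
      { modular = canonical-descending⇒modular D
          (rows⁺ D (RowBounds.canonical ∘ diagramOf-rowBounds))
          (rows⁺ D (RowBounds.label≥1 ∘ diagramOf-rowBounds))
          diagramOf-descending
      ; inBox   = RowBounds.length≤ ∘ diagramOf-rowBounds
      ; cond1   = λ ℓ 1≤ℓ ℓ≤N → trans (sym (List.length-map rowLen (labelledRows D ℓ)))
                    (trans (Perm.↭-length (labelledLengths-diagramOf 1≤ℓ ℓ≤N))
                           (length-evenSplit k (base + nth s (ℓ ∸ 1))))
      ; cond2   = λ { (suc i) 1≤ℓ ℓ<N →
                    subst₂ _≤_ (sym (labelSum-diagramOf 1≤ℓ (<⇒≤ ℓ<N))) (sym (labelSum-diagramOf (s≤s z≤n) ℓ<N))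
                    (+-monoʳ-≤ base (nth-mono sorted (subst (suc i <_) (sym length≡) ℓ<N))) }
      ; cond2'  = begin
          labelSum D N + b               ≡⟨ cong (_+ b) (labelSum-diagramOf (s≤s z≤n) ≤-refl) ⟩
          base + nth s N′ + b
            ≤⟨ +-monoˡ-≤ b (+-monoʳ-≤ base (All.lookup bounded (nth-∈ (subst (N′ <_) (sym length≡) ≤-refl)))) ⟩
          base + M + b                   ≡⟨ M-bound ⟩
          k * (a + 1)                    ∎
      ; cond3   = RowBounds.length≥ ∘ diagramOf-rowBounds
      ; cond4   = balanced⇒spread≤1 D λ i → let open RowBounds (diagramOf-rowBounds i) in
          balanced-resp-↭ (↭-sym (labelledLengths-diagramOf label≥1 (canonical-label≤ canonical)))
                          (evenSplit-balanced k (base + nth s (rowLabel (row D i) ∸ 1)))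
      }
      where open ≤-Reasoning

  excess : Diagram b → ℕ → ℕ
  excess D i = labelSum D (suc i) ∸ base

  seqOf : Diagram b → List ℕ
  seqOf D = applyUpTo (excess D) N

  seqOf-diagramOf : ∀ {M} → base + M + b ≡ k * (a + 1) → ∀ {s} → IncreasingSeq M N s →
                    seqOf (diagramOf s) ≡ s
  seqOf-diagramOf M-bound {s} seq = subst (λ n → applyUpTo (excess (diagramOf s)) n ≡ s) length≡
    (applyUpTo-nth (excess (diagramOf s)) λ {i} i<length →
      trans (cong (_∸ base) (labelSum-diagramOf M-bound seq (s≤s z≤n) (subst (suc i ≤_) length≡ i<length)))
            (m+n∸m≡n base (nth s i)))
    where open IncreasingSeq seq

  base≤labelSum : ∀ {D} → Good a b k N D → ∀ {ℓ} → 1 ≤ ℓ → ℓ ≤ N → base ≤ labelSum D ℓ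
  base≤labelSum {D} good {ℓ} 1≤ℓ ℓ≤N =
    subst (_≤ labelSum D ℓ) (cong (N′ *_) (length-labelledLengths good 1≤ℓ ℓ≤N))
    (length*≤sum (All.map⁺ (All.filter⁺ _ (rows⁺ D (Good.cond3 good)))))

  module _ {M : ℕ} (M-bound : base + M + b ≡ k * (a + 1)) {D : Diagram b} (good : Good a b k N D) where
    open Good good

    labelSum≤last : ∀ d {ℓ} → 1 ≤ ℓ → ℓ + d ≡ N → labelSum D ℓ ≤ labelSum D N
    labelSum≤last zero    {ℓ} _   ℓ+0≡N = ≤-reflexive (cong (labelSum D) (trans (sym (+-identityʳ ℓ)) ℓ+0≡N))
    labelSum≤last (suc d) {ℓ} 1≤ℓ ℓ+d+1≡N = ≤-trans
      (cond2 ℓ 1≤ℓ (subst (ℓ <_) ℓ+d+1≡N (m<m+n ℓ (s≤s z≤n))))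
      (labelSum≤last d (s≤s z≤n) (trans (sym (+-suc ℓ d)) ℓ+d+1≡N))

    labelSum≤base+M : ∀ {ℓ} → 1 ≤ ℓ → ℓ ≤ N → labelSum D ℓ ≤ base + M
    labelSum≤base+M 1≤ℓ ℓ≤N = ≤-trans (labelSum≤last _ 1≤ℓ (m+[n∸m]≡n ℓ≤N))
      (+-cancelʳ-≤ b (labelSum D N) (base + M) (subst (labelSum D N + b ≤_) (sym M-bound) cond2'))

    seqOf-increasing : IncreasingSeq M N (seqOf D)
    seqOf-increasing = record
      { length≡ = List.length-applyUpTo (excess D) N
      ; sorted  = Linked.applyUpTo⁺₁ (excess D) N λ {i} i+1<N → ∸-monoˡ-≤ base (cond2 (suc i) (s≤s z≤n) i+1<N)
      ; bounded = All.applyUpTo⁺₁ (excess D) N λ {i} i<N →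
          subst (labelSum D (suc i) ∸ base ≤_) (m+n∸m≡n base M) (∸-monoˡ-≤ base (labelSum≤base+M (s≤s z≤n) i<N))
      }

    diagramOf-seqOf : diagramOf (seqOf D) ≡ D
    diagramOf-seqOf = good-unique (diagramOf-good M-bound seqOf-increasing) good labelSums≡
      where
      open ≡-Reasoning
      labelSums≡ : ∀ ℓ → 1 ≤ ℓ → ℓ ≤ N → labelSum (diagramOf (seqOf D)) ℓ ≡ labelSum D ℓ
      labelSums≡ (suc i) 1≤ℓ ℓ≤N = begin
        labelSum (diagramOf (seqOf D)) (suc i)   ≡⟨ labelSum-diagramOf M-bound seqOf-increasing 1≤ℓ ℓ≤N ⟩
        base + nth (seqOf D) i                   ≡⟨ cong (base +_) (nth-applyUpTo (excess D) ℓ≤N) ⟩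
        base + (labelSum D (suc i) ∸ base)       ≡⟨ m+[n∸m]≡n (base≤labelSum good 1≤ℓ ℓ≤N) ⟩
        labelSum D (suc i)                       ∎

  enumeration : ∀ {M} → base + M + b ≡ k * (a + 1) →
                SizeEnumeration (Good a b k N) (shift (N * base) (gauss (M + N) N))
  enumeration {M} M-bound = map diagramOf seqs , unique , members , counts
    where
    seqs = increasingSeqs M N

    unique : Unique (map diagramOf seqs)
    unique = Unique.map⁻ (subst Unique (sym seqOf∘diagramOf) (increasingSeqs-unique M N))
      where
      seqOf∘diagramOf : map seqOf (map diagramOf seqs) ≡ seqs
      seqOf∘diagramOf = trans (sym (List.map-∘ seqs))
        (List.map-id-local (All.map (seqOf-diagramOf M-bound) (increasingSeqs-sound M N)))

    members : ∀ D → (D ∈ map diagramOf seqs) ⇔ Good a b k N D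
    members D = mk⇔
      (λ D∈ → let s , s∈ , D≡ = ∈-map⁻ diagramOf D∈ in
        subst (Good a b k N) (sym D≡) (diagramOf-good M-bound (All.lookup (increasingSeqs-sound M N) s∈)))
      (λ good → subst (_∈ map diagramOf seqs) (diagramOf-seqOf M-bound good)
        (∈-map⁺ diagramOf (increasingSeqs-complete M N (seqOf-increasing M-bound good))))

    counts : ∀ d → count (λ D → size D ≟ d) (map diagramOf seqs) ≡ shift (N * base) (gauss (M + N) N) d
    counts d = begin
      count (λ D → size D ≟ d) (map diagramOf seqs)
        ≡⟨ count-map _ diagramOf seqs ⟩
      count (λ s → size (diagramOf s) ≟ d) seqs
        ≡⟨ count-≟-cong d (All.map (size-diagramOf M-bound) (increasingSeqs-sound M N)) ⟩
      count (λ s → sum s + N * base ≟ d) seqs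
        ≡⟨ count-+-shift sum (N * base) seqs d ⟩
      shift (N * base) (λ d′ → count (λ s → sum s ≟ d′) seqs) d
        ≡⟨ shift-cong (N * base) (count-sum-increasingSeqs M N) d ⟩
      shift (N * base) (gauss (M + N) N) d
        ∎
      where open ≡-Reasoning

  k[a+1]+b≡k[a+2]+base : k * (a + 1) + b ≡ k * (a + 2) + base
  k[a+1]+b≡k[a+2]+base = lemma a N′ k′
    where
    lemma : ∀ a N′ k′ → suc k′ * (a + 1) + suc N′ * suc k′ ≡ suc k′ * (a + 2) + N′ * suc k′
    lemma = solve-∀

  good⇒2b≤k[a+2] : ∀ {D} → Good a b k N D → 2 * b ≤ k * (a + 2)
  good⇒2b≤k[a+2] {D} good = +-cancelʳ-≤ base (2 * b) (k * (a + 2)) (begin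
    2 * b + base               ≡⟨ lemma b base ⟩
    base + b + b               ≤⟨ +-monoˡ-≤ b (+-monoˡ-≤ b (base≤labelSum good (s≤s z≤n) ≤-refl)) ⟩
    labelSum D N + b + b       ≤⟨ +-monoˡ-≤ b (Good.cond2' good) ⟩
    k * (a + 1) + b            ≡⟨ k[a+1]+b≡k[a+2]+base ⟩
    k * (a + 2) + base         ∎)
    where
    open ≤-Reasoning
    lemma : ∀ b base → 2 * b + base ≡ base + b + b
    lemma = solve-∀

  module _ (2b≤ : 2 * b ≤ k * (a + 2)) where

    private
      M = k * (a + 2) ∸ 2 * b
      M+2b≡ : M + 2 * b ≡ k * (a + 2)
      M+2b≡ = m∸n+n≡m 2b≤

    excess-bound : base + M + b ≡ k * (a + 1)
    excess-bound = +-cancelʳ-≡ b _ _ (begin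
      base + M + b + b       ≡⟨ lemma base M b ⟩
      M + 2 * b + base       ≡⟨ cong (_+ base) M+2b≡ ⟩
      k * (a + 2) + base     ≡⟨ k[a+1]+b≡k[a+2]+base ⟨
      k * (a + 1) + b        ∎)
      where
      open ≡-Reasoning
      lemma : ∀ base M b → base + M + b + b ≡ M + 2 * b + base
      lemma = solve-∀

    gauss-index≡ : k * (a + 2) + N ∸ 2 * b ≡ M + N
    gauss-index≡ = begin
      k * (a + 2) + N ∸ 2 * b     ≡⟨ cong (λ n → n + N ∸ 2 * b) M+2b≡ ⟨
      M + 2 * b + N ∸ 2 * b       ≡⟨ cong (_∸ 2 * b) (lemma M (2 * b) N) ⟩
      M + N + 2 * b ∸ 2 * b       ≡⟨ m+n∸n≡m (M + N) (2 * b) ⟩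
      M + N                       ∎
      where
      open ≡-Reasoning
      lemma : ∀ m n o → m + n + o ≡ m + o + n
      lemma = solve-∀

  gauss-index< : k * (a + 2) < 2 * b → k * (a + 2) + N ∸ 2 * b < N
  gauss-index< k[a+2]<2b = s≤s (begin
    k * (a + 2) + N ∸ 2 * b                  ≤⟨ ∸-monoʳ-≤ (k * (a + 2) + N) k[a+2]<2b ⟩
    k * (a + 2) + suc N′ ∸ suc (k * (a + 2)) ≡⟨ cong (_∸ suc (k * (a + 2))) (+-suc (k * (a + 2)) N′) ⟩
    k * (a + 2) + N′ ∸ k * (a + 2)           ≡⟨ m+n∸m≡n (k * (a + 2)) N′ ⟩
    N′                                       ∎)
    where open ≤-Reasoning

  goodDiagrams : SizeEnumeration (Good a b k N) (shift (N * base) (gauss (k * (a + 2) + N ∸ 2 * b) N))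
  goodDiagrams with 2 * b ≤? k * (a + 2)
  ... | yes 2b≤ = subst (λ n → SizeEnumeration (Good a b k N) (shift (N * base) (gauss n N)))
                        (sym (gauss-index≡ 2b≤)) (enumeration (excess-bound 2b≤))
  ... | no 2b≰ = [] , [] , (λ D → mk⇔ (λ ()) (λ good → contradiction (good⇒2b≤k[a+2] good) 2b≰)) ,
                 λ d → sym (shift-zero (N * base) (gauss-vanishes (gauss-index< (≰⇒> 2b≰))) d)

  b/k≡N : b / k ≡ N
  b/k≡N = m*n/n≡m N k

  b*b/k∸b≡N*base : b * b / k ∸ b ≡ N * base
  b*b/k∸b≡N*base = begin
    b * b / k ∸ b         ≡⟨ cong (λ n → n / k ∸ b) (lemma₁ N′ k′) ⟩
    N * b * k / k ∸ b     ≡⟨ cong (_∸ b) (m*n/n≡m (N * b) k) ⟩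
    N * b ∸ b             ≡⟨ cong (_∸ b) (lemma₂ N′ k′) ⟩
    N * base + b ∸ b      ≡⟨ m+n∸n≡m (N * base) b ⟩
    N * base              ∎
    where
    open ≡-Reasoning
    lemma₁ : ∀ N′ k′ → suc N′ * suc k′ * (suc N′ * suc k′) ≡ suc N′ * (suc N′ * suc k′) * suc k′
    lemma₁ = solve-∀
    lemma₂ : ∀ N′ k′ → suc N′ * (suc N′ * suc k′) ≡ suc N′ * (N′ * suc k′) + suc N′ * suc k′
    lemma₂ = solve-∀

corollary3p5 : (a b k : ℕ) .{{_ : NonZero k}} → 0 < a → 0 < b → k ∣ b →
  Σ[ L ∈ List (Diagram b) ]
    ( Unique L
    × (∀ D → (D ∈ L) ⇔ Good a b k (b / k) D)
    × (∀ d → length (filter (λ D → size D ≟ d) L)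
             ≡ shift (b * b / k ∸ b)
                     (gauss ((k * (a + 2) + b / k) ∸ (2 * b)) (b / k)) d) )
corollary3p5 a _ (suc k′) _ () (divides zero refl)
corollary3p5 a _ (suc k′) _ _  (divides (suc N′) refl)
  rewrite Construction.b/k≡N a N′ k′ | Construction.b*b/k∸b≡N*base a N′ k′
  = Construction.goodDiagrams a N′ k′
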